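{- For any positive integer $n$, the following identity of rational functions in $q$ holds: $$ (-1)^nq^{\binom{n+1}{2}}\sum_{k=1}^n\frac{q^{ -nk}(q;q)_k}{[k][k-n-1](q^{ -n};q)_k}=\sum_{k=1}^n\frac{(-1)^kq^{\binom{k+1}{2}}(1+q^k)}{[k]^2}+\sum_{k=1}^n\frac{q^k}{[k]^2}. $$
   Context: For an integer $x$ (possibly negative), $[x]=(1-q^x)/(1-q)$. $(b;q)_0=1$ and $(b;q)_k=(1-b)(1-bq)\cdots(1-bq^{k-1})$ for $k\ge1$. -}

module Defs where

open import Data.Nat as ℕ using (ℕ; zero; suc)
open import Data.Integer as ℤ using (ℤ; +_; -[1+_])
open import Data.Rational using (ℚ; 0ℚ; 1ℚ; _+_; _*_; _-_; -_; 1/_; ≢-nonZero; _≟_)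
open import Relation.Nullary using (yes; no)

-- Total multiplicative inverse on ℚ: inv 0 = 0 (only ever used at nonzero
-- arguments under the hypotheses of the theorem).
inv : ℚ → ℚ
inv p with p ≟ 0ℚ
... | yes _  = 0ℚ
... | no p≢0 = 1/_ p {{≢-nonZero p≢0}}

_÷_ : ℚ → ℚ → ℚ
x ÷ y = x * inv y
infixl 7 _÷_

_^ℕ_ : ℚ → ℕ → ℚ
q ^ℕ zero  = 1ℚ
q ^ℕ suc k = q * (q ^ℕ k)
infixr 8 _^ℕ_

_^ℤ_ : ℚ → ℤ → ℚ
q ^ℤ (+ k)    = q ^ℕ k
q ^ℤ -[1+ k ] = inv (q ^ℕ suc k)
infixr 8 _^ℤ_

qint : ℚ → ℤ → ℚ
qint q x = (1ℚ - q ^ℤ x) ÷ (1ℚ - q)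

poch : ℚ → ℚ → ℕ → ℚ
poch b q zero    = 1ℚ
poch b q (suc k) = poch b q k * (1ℚ - b * q ^ℕ k)

sum1 : ℕ → (ℕ → ℚ) → ℚ
sum1 zero    f = 0ℚ
sum1 (suc n) f = sum1 n f + f (suc n)

sgn : ℕ → ℚ
sgn m = (- 1ℚ) ^ℕ m

-- Write t n k for the k-th summand on the left, r n k = q⁻ⁿᵏ (q;q)ₖ / (q⁻ⁿ;q)ₖ, so that
-- t n k = r n k / ([k] [k-n-1]), and c n = (-1)ⁿ q^C(n+1,2).  The ratios r obey first-order
-- recurrences in k and in (n, k) (peel one factor off each Pochhammer symbol), and with
-- them, for 1 ≤ k ≤ n and the "potential" h n k = c n r n k / qᵏ,
--   c (n+1) t (n+1) (k+1) = c n t n k + q^(n+1)/[n+1]² · (h n k - h n (k-1)).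
-- Summing over k telescopes; since h n n = 1, h n 0 = c n and t (n+1) 1 = q^(n+1)/[n+1]²,
-- the left side grows from n to n+1 by exactly the (n+1)-st terms of the two sums on the
-- right, and the identity follows by induction on n.
module Submission where

open import Defs
open import Data.Nat as ℕ using (ℕ; zero; suc; _≥_)
import Data.Nat.Properties as ℕ
open import Data.Nat.Combinatorics using (_C_; nCk+nC[k+1]≡[n+1]C[k+1]; nC1≡n)
open import Data.Integer as ℤ using (+_)
import Data.Integer.Properties as ℤ
open import Data.Rational
  using (ℚ; 0ℚ; 1ℚ; _+_; _*_; _-_; -_; _≟_; ≢-nonZero; ∣_∣; _<_; NonNegative)
import Data.Rational.Properties as ℚ
open import Data.Rational.Solver using (module +-*-Solver)
open import Data.Fin as Fin using (Fin)
open import Data.Maybe using (Maybe; just; nothing)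
import Data.Maybe.Properties as Maybe
open import Data.Vec using (Vec; []; _∷_; lookup; allFin)
import Data.Vec as Vec
open import Data.Vec.N-ary using (N-ary; _$ⁿ_)
open import Data.List using (List; []; _∷_; _++_; deduplicate)
open import Data.List.Relation.Unary.All using (All; []; _∷_)
open import Data.List.Relation.Unary.All.Properties using (++⁻ˡ; ++⁻ʳ; deduplicate⁻)
open import Data.Product using (_×_; _,_; proj₁; proj₂)
open import Data.Sum using (inj₁; inj₂)
open import Function using (_∘_)
open import Relation.Nullary using (Dec; yes; no)
open import Relation.Nullary.Decidable using (map′; _×-dec_)
open import Relation.Nullary.Negation using (contradiction)
open import Relation.Binary.Definitions using (DecidableEquality; tri<; tri≈; tri>)
open import Relation.Binary.PropositionalEquality
open ≡-Reasoning

open +-*-Solver using (Polynomial; normalise; ⟦_⟧N; correct; solve; _:=_; _:+_; _:*_; :-_)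
  renaming (⟦_⟧ to ⟦_⟧ₚ; var to pvar; con to pcon)

inv-inverseˡ : ∀ {p} → p ≢ 0ℚ → inv p * p ≡ 1ℚ
inv-inverseˡ {p} p≢0 with p ≟ 0ℚ
... | yes p≡0 = contradiction p≡0 p≢0
... | no  p≢0 = ℚ.*-inverseˡ p {{≢-nonZero p≢0}}

*-cancelʳ-≡ : ∀ {p q r} → r ≢ 0ℚ → p * r ≡ q * r → p ≡ q
*-cancelʳ-≡ {p} {q} {r} r≢0 pr≡qr = begin
  p                  ≡⟨ divide-out p ⟨
  p * r * inv r      ≡⟨ cong (_* inv r) pr≡qr ⟩
  q * r * inv r      ≡⟨ divide-out q ⟩
  q                  ∎
  where
  divide-out : ∀ x → x * r * inv r ≡ x
  divide-out x = begin
    x * r * inv r    ≡⟨ solve 3 (λ x r r⁻¹ → x :* r :* r⁻¹ := x :* (r⁻¹ :* r)) refl x r (inv r) ⟩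
    x * (inv r * r)  ≡⟨ cong (x *_) (inv-inverseˡ r≢0) ⟩
    x * 1ℚ           ≡⟨ ℚ.*-identityʳ x ⟩
    x                ∎

*-≢0 : ∀ {p q} → p ≢ 0ℚ → q ≢ 0ℚ → p * q ≢ 0ℚ
*-≢0 {p} {q} p≢0 q≢0 pq≡0 = q≢0 (*-cancelʳ-≡ p≢0 (begin
  q * p   ≡⟨ ℚ.*-comm q p ⟩
  p * q   ≡⟨ pq≡0 ⟩
  0ℚ      ≡⟨ ℚ.*-zeroˡ p ⟨
  0ℚ * p  ∎))

neg-≢0 : ∀ {p} → p ≢ 0ℚ → - p ≢ 0ℚ
neg-≢0 p≢0 -p≡0 = p≢0 (ℚ.neg-injective -p≡0)

inv-≢0 : ∀ {p} → p ≢ 0ℚ → inv p ≢ 0ℚ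
inv-≢0 {p} p≢0 p⁻¹≡0 = ℚ.1≢0 (begin
  1ℚ         ≡⟨ inv-inverseˡ p≢0 ⟨
  inv p * p  ≡⟨ cong (_* p) p⁻¹≡0 ⟩
  0ℚ * p     ≡⟨ ℚ.*-zeroˡ p ⟩
  0ℚ         ∎)

-- No side conditions: the junk value inv 0ℚ = 0ℚ makes both sides vanish.
inv-distrib-* : ∀ p r → inv (p * r) ≡ inv p * inv r
inv-distrib-* p r = by-cases p r (p ≟ 0ℚ) (r ≟ 0ℚ)
  where
  by-cases : ∀ p r → Dec (p ≡ 0ℚ) → Dec (r ≡ 0ℚ) → inv (p * r) ≡ inv p * inv r
  by-cases p r (yes refl) _          = trans (cong inv (ℚ.*-zeroˡ r)) (sym (ℚ.*-zeroˡ (inv r)))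
  by-cases p r (no _)     (yes refl) = trans (cong inv (ℚ.*-zeroʳ p)) (sym (ℚ.*-zeroʳ (inv p)))
  by-cases p r (no p≢0)   (no r≢0)   = *-cancelʳ-≡ (*-≢0 p≢0 r≢0) (begin
    inv (p * r) * (p * r)      ≡⟨ inv-inverseˡ (*-≢0 p≢0 r≢0) ⟩
    1ℚ                         ≡⟨ cong₂ _*_ (inv-inverseˡ p≢0) (inv-inverseˡ r≢0) ⟨
    inv p * p * (inv r * r)    ≡⟨ solve 4 (λ p⁻¹ p r⁻¹ r → p⁻¹ :* p :* (r⁻¹ :* r) := p⁻¹ :* r⁻¹ :* (p :* r))
                                    refl (inv p) p (inv r) r ⟩
    inv p * inv r * (p * r)    ∎)

-≢0 : ∀ {p r} → p ≢ r → p - r ≢ 0ℚ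
-≢0 {p} {r} p≢r p-r≡0 = p≢r (begin
  p              ≡⟨ solve 2 (λ p r → p := p :- r :+ r) refl p r ⟩
  p - r + r      ≡⟨ cong (_+ r) p-r≡0 ⟩
  0ℚ + r         ≡⟨ ℚ.+-identityˡ r ⟩
  r              ∎)
  where open +-*-Solver using (_:-_)

*÷≡1⇒≡ : ∀ {p r} → r ≢ 0ℚ → p * inv r ≡ 1ℚ → p ≡ r
*÷≡1⇒≡ {p} {r} r≢0 p/r≡1 = begin
  p                  ≡⟨ ℚ.*-identityʳ p ⟨
  p * 1ℚ             ≡⟨ cong (p *_) (inv-inverseˡ r≢0) ⟨
  p * (inv r * r)    ≡⟨ ℚ.*-assoc p (inv r) r ⟨
  p * inv r * r      ≡⟨ cong (_* r) p/r≡1 ⟩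
  1ℚ * r             ≡⟨ ℚ.*-identityˡ r ⟩
  r                  ∎

-- A normaliser for field expressions

-- An expression denotes numerator/denominator, two polynomials; two expressions are equal
-- once their cross-multiplied numerators have the same normal form, provided that every
-- factor of every inverted subexpression is nonzero.  field-solve asks for these side
-- conditions once each, in order of first occurrence.  The operations are tags of only
-- three constructors so that decidable equality, used for that deduplication, stays short.

infixl 6 _⊕_ _⊖_
infixl 7 _⊗_ _⊘_
infix 8 ⊝_
infix 9 _⁻¹
infix 4 _⊜_

data Expr (m : ℕ) : Set where
  leaf : Maybe (Fin m) → Expr m
  bin  : Fin 2 → Expr m → Expr m → Expr m
  un   : Fin 2 → Expr m → Expr m

pattern var i   = leaf (just i)
pattern one     = leaf nothing
pattern _⊕_ a b = bin Fin.zero a b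
pattern _⊗_ a b = bin (Fin.suc Fin.zero) a b
pattern ⊝_ a    = un Fin.zero a
pattern _⁻¹ a   = un (Fin.suc Fin.zero) a

_⊖_ _⊘_ : ∀ {m} → Expr m → Expr m → Expr m
a ⊖ b = a ⊕ ⊝ b
a ⊘ b = a ⊗ b ⁻¹

_⊜_ : ∀ {m} → Expr m → Expr m → Expr m × Expr m
_⊜_ = _,_

_≟ₑ_ : ∀ {m} → DecidableEquality (Expr m)
leaf x ≟ₑ leaf y = map′ (cong leaf) (λ { refl → refl }) (Maybe.≡-dec Fin._≟_ x y)
bin o a b ≟ₑ bin o′ a′ b′ = map′ (λ { (refl , refl , refl) → refl }) (λ { refl → refl , refl , refl })
  (o Fin.≟ o′ ×-dec a ≟ₑ a′ ×-dec b ≟ₑ b′)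
un o a ≟ₑ un o′ a′ = map′ (λ { (refl , refl) → refl }) (λ { refl → refl , refl })
  (o Fin.≟ o′ ×-dec a ≟ₑ a′)
leaf _    ≟ₑ bin _ _ _ = no λ ()
leaf _    ≟ₑ un _ _    = no λ ()
bin _ _ _ ≟ₑ leaf _    = no λ ()
bin _ _ _ ≟ₑ un _ _    = no λ ()
un _ _    ≟ₑ leaf _    = no λ ()
un _ _    ≟ₑ bin _ _ _ = no λ ()

⟦_⟧ : ∀ {m} → Expr m → Vec ℚ m → ℚ
⟦ var i ⟧ ρ = lookup ρ i
⟦ one ⟧   ρ = 1ℚ
⟦ a ⊕ b ⟧ ρ = ⟦ a ⟧ ρ + ⟦ b ⟧ ρ
⟦ a ⊗ b ⟧ ρ = ⟦ a ⟧ ρ * ⟦ b ⟧ ρ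
⟦ ⊝ a ⟧   ρ = - ⟦ a ⟧ ρ
⟦ a ⁻¹ ⟧  ρ = inv (⟦ a ⟧ ρ)

factors : ∀ {m} → Expr m → List (Expr m)
factors (a ⊗ b) = factors a ++ factors b
factors (⊝ a)   = factors a
factors (a ⁻¹)  = factors a
factors e       = e ∷ []

inverted : ∀ {m} → Expr m → List (Expr m)
inverted (leaf _)    = []
inverted (bin _ a b) = inverted a ++ inverted b
inverted (⊝ a)       = inverted a
inverted (a ⁻¹)      = inverted a ++ factors a

numerator denominator : ∀ {m} → Expr m → Polynomial m
numerator (var i) = pvar i
numerator one     = pcon 1ℚ
numerator (a ⊕ b) = numerator a :* denominator b :+ numerator b :* denominator a
numerator (a ⊗ b) = numerator a :* numerator b
numerator (⊝ a)   = :- numerator a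
numerator (a ⁻¹)  = denominator a
denominator (leaf _)    = pcon 1ℚ
denominator (bin _ a b) = denominator a :* denominator b
denominator (⊝ a)       = denominator a
denominator (a ⁻¹)      = numerator a

+-fraction : ∀ x y d e {n o} → x * d ≡ n → y * e ≡ o → (x + y) * (d * e) ≡ n * e + o * d
+-fraction x y d e refl refl =
  solve 4 (λ x y d e → (x :+ y) :* (d :* e) := x :* d :* e :+ y :* e :* d) refl x y d e

*-fraction : ∀ x y d e {n o} → x * d ≡ n → y * e ≡ o → (x * y) * (d * e) ≡ n * o
*-fraction x y d e refl refl =
  solve 4 (λ x y d e → (x :* y) :* (d :* e) := (x :* d) :* (y :* e)) refl x y d e

neg-fraction : ∀ x d {n} → x * d ≡ n → - x * d ≡ - n
neg-fraction x d refl = sym (ℚ.neg-distribˡ-* x d)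

inv-fraction : ∀ x d {n} → x ≢ 0ℚ → x * d ≡ n → inv x * n ≡ d
inv-fraction x d x≢0 refl = begin
  inv x * (x * d)     ≡⟨ ℚ.*-assoc (inv x) x d ⟨
  inv x * x * d       ≡⟨ cong (_* d) (inv-inverseˡ x≢0) ⟩
  1ℚ * d              ≡⟨ ℚ.*-identityˡ d ⟩
  d                   ∎

fraction-cancel : ∀ x y d e {n o} → d ≢ 0ℚ → e ≢ 0ℚ → x * d ≡ n → y * e ≡ o → n * e ≡ o * d → x ≡ y
fraction-cancel x y d e d≢0 e≢0 refl refl cross = *-cancelʳ-≡ (*-≢0 d≢0 e≢0) (begin
  x * (d * e)   ≡⟨ ℚ.*-assoc x d e ⟨
  x * d * e     ≡⟨ cross ⟩
  y * e * d     ≡⟨ ℚ.*-assoc y e d ⟩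
  y * (e * d)   ≡⟨ cong (y *_) (ℚ.*-comm e d) ⟩
  y * (d * e)   ∎)

module _ {m} (ρ : Vec ℚ m) where

  NonZero : Expr m → Set
  NonZero d = ⟦ d ⟧ ρ ≢ 0ℚ

  factors-≢0 : ∀ e → All NonZero (factors e) → NonZero e
  factors-≢0 (a ⊗ b)  nz = *-≢0 (factors-≢0 a (++⁻ˡ (factors a) nz)) (factors-≢0 b (++⁻ʳ (factors a) nz))
  factors-≢0 (⊝ a)    nz = neg-≢0 (factors-≢0 a nz)
  factors-≢0 (a ⁻¹)   nz = inv-≢0 (factors-≢0 a nz)
  factors-≢0 (leaf _) (nz ∷ []) = nz
  factors-≢0 (a ⊕ b)  (nz ∷ []) = nz

  denominator-≢0 : ∀ e → All NonZero (inverted e) → ⟦ denominator e ⟧ₚ ρ ≢ 0ℚ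
  fraction       : ∀ e → All NonZero (inverted e) → ⟦ e ⟧ ρ * ⟦ denominator e ⟧ₚ ρ ≡ ⟦ numerator e ⟧ₚ ρ

  denominator-≢0 (leaf _)    _  = ℚ.1≢0
  denominator-≢0 (bin _ a b) nz =
    *-≢0 (denominator-≢0 a (++⁻ˡ (inverted a) nz)) (denominator-≢0 b (++⁻ʳ (inverted a) nz))
  denominator-≢0 (⊝ a)       nz = denominator-≢0 a nz
  denominator-≢0 (a ⁻¹)      nz = λ n≡0 → a≢0 (*-cancelʳ-≡ d≢0 (begin
    ⟦ a ⟧ ρ * ⟦ denominator a ⟧ₚ ρ  ≡⟨ fraction a (++⁻ˡ (inverted a) nz) ⟩
    ⟦ numerator a ⟧ₚ ρ              ≡⟨ n≡0 ⟩
    0ℚ                              ≡⟨ ℚ.*-zeroˡ (⟦ denominator a ⟧ₚ ρ) ⟨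
    0ℚ * ⟦ denominator a ⟧ₚ ρ       ∎))
    where
    a≢0 : NonZero a
    a≢0 = factors-≢0 a (++⁻ʳ (inverted a) nz)
    d≢0 : ⟦ denominator a ⟧ₚ ρ ≢ 0ℚ
    d≢0 = denominator-≢0 a (++⁻ˡ (inverted a) nz)

  fraction (var i) _  = ℚ.*-identityʳ (lookup ρ i)
  fraction one     _  = refl
  fraction (a ⊕ b) nz = +-fraction (⟦ a ⟧ ρ) (⟦ b ⟧ ρ) (⟦ denominator a ⟧ₚ ρ) (⟦ denominator b ⟧ₚ ρ)
    (fraction a (++⁻ˡ (inverted a) nz)) (fraction b (++⁻ʳ (inverted a) nz))
  fraction (a ⊗ b) nz = *-fraction (⟦ a ⟧ ρ) (⟦ b ⟧ ρ) (⟦ denominator a ⟧ₚ ρ) (⟦ denominator b ⟧ₚ ρ)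
    (fraction a (++⁻ˡ (inverted a) nz)) (fraction b (++⁻ʳ (inverted a) nz))
  fraction (⊝ a)   nz = neg-fraction (⟦ a ⟧ ρ) (⟦ denominator a ⟧ₚ ρ) (fraction a nz)
  fraction (a ⁻¹)  nz = inv-fraction (⟦ a ⟧ ρ) (⟦ denominator a ⟧ₚ ρ)
    (factors-≢0 a (++⁻ʳ (inverted a) nz)) (fraction a (++⁻ˡ (inverted a) nz))

close : ∀ m → N-ary m (Expr m) (Expr m × Expr m) → Expr m × Expr m
close m f = f $ⁿ Vec.map var (allFin m)

field-solve : ∀ m (f : N-ary m (Expr m) (Expr m × Expr m)) (ρ : Vec ℚ m) →
              let e₁ = proj₁ (close m f); e₂ = proj₂ (close m f) in
              All (NonZero ρ) (deduplicate _≟ₑ_ (inverted e₁ ++ inverted e₂)) →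
              normalise (numerator e₁ :* denominator e₂) ≡ normalise (numerator e₂ :* denominator e₁) →
              ⟦ e₁ ⟧ ρ ≡ ⟦ e₂ ⟧ ρ
field-solve m f ρ nonzero same-normal-form =
  fraction-cancel (⟦ e₁ ⟧ ρ) (⟦ e₂ ⟧ ρ) (⟦ denominator e₁ ⟧ₚ ρ) (⟦ denominator e₂ ⟧ₚ ρ)
    (denominator-≢0 ρ e₁ nz₁) (denominator-≢0 ρ e₂ nz₂) (fraction ρ e₁ nz₁) (fraction ρ e₂ nz₂)
    (begin
      ⟦ numerator e₁ :* denominator e₂ ⟧ₚ ρ   ≡⟨ correct (numerator e₁ :* denominator e₂) ρ ⟨
      ⟦ normalise (numerator e₁ :* denominator e₂) ⟧N ρ ≡⟨ cong (λ p → ⟦ p ⟧N ρ) same-normal-form ⟩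
      ⟦ normalise (numerator e₂ :* denominator e₁) ⟧N ρ ≡⟨ correct (numerator e₂ :* denominator e₁) ρ ⟩
      ⟦ numerator e₂ :* denominator e₁ ⟧ₚ ρ   ∎)
  where
  e₁ e₂ : Expr m
  e₁ = proj₁ (close m f)
  e₂ = proj₂ (close m f)
  nz : All (NonZero ρ) (inverted e₁ ++ inverted e₂)
  nz = deduplicate⁻ _≟ₑ_ (λ { refl d≢0 → d≢0 }) (inverted e₁ ++ inverted e₂) nonzero
  nz₁ : All (NonZero ρ) (inverted e₁)
  nz₁ = ++⁻ˡ (inverted e₁) nz
  nz₂ : All (NonZero ρ) (inverted e₂)
  nz₂ = ++⁻ʳ (inverted e₁) nz

^ℕ-distribˡ-+-* : ∀ q a b → q ^ℕ (a ℕ.+ b) ≡ q ^ℕ a * q ^ℕ b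
^ℕ-distribˡ-+-* q zero    b = sym (ℚ.*-identityˡ (q ^ℕ b))
^ℕ-distribˡ-+-* q (suc a) b = begin
  q * q ^ℕ (a ℕ.+ b)      ≡⟨ cong (q *_) (^ℕ-distribˡ-+-* q a b) ⟩
  q * (q ^ℕ a * q ^ℕ b)   ≡⟨ ℚ.*-assoc q (q ^ℕ a) (q ^ℕ b) ⟨
  q * q ^ℕ a * q ^ℕ b     ∎

^ℕ-≢0 : ∀ {q} → q ≢ 0ℚ → ∀ m → q ^ℕ m ≢ 0ℚ
^ℕ-≢0 q≢0 zero    = ℚ.1≢0
^ℕ-≢0 q≢0 (suc m) = *-≢0 q≢0 (^ℕ-≢0 q≢0 m)

^ℤ-neg : ∀ q m → q ^ℤ ℤ.- (+ m) ≡ inv (q ^ℕ m)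
^ℤ-neg q zero    = refl
^ℤ-neg q (suc m) = refl

^ℤ-⊖ : ∀ {q} → q ≢ 0ℚ → ∀ a b → q ^ℤ (a ℤ.⊖ b) ≡ q ^ℕ a * inv (q ^ℕ b)
^ℤ-⊖ {q} _   a       zero    = sym (ℚ.*-identityʳ (q ^ℕ a))
^ℤ-⊖ {q} _   zero    (suc b) = sym (ℚ.*-identityˡ (inv (q ^ℕ suc b)))
^ℤ-⊖ {q} q≢0 (suc a) (suc b) = begin
  q ^ℤ (suc a ℤ.⊖ suc b)             ≡⟨ cong (q ^ℤ_) (ℤ.[1+m]⊖[1+n]≡m⊖n a b) ⟩
  q ^ℤ (a ℤ.⊖ b)                     ≡⟨ ^ℤ-⊖ q≢0 a b ⟩
  q ^ℕ a * inv (q ^ℕ b)              ≡⟨ field-solve 3 (λ q A B → A ⊘ B ⊜ q ⊗ A ⊘ (q ⊗ B))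
                                          (q ∷ q ^ℕ a ∷ q ^ℕ b ∷ []) (^ℕ-≢0 q≢0 b ∷ q≢0 ∷ []) refl ⟩
  q ^ℕ suc a * inv (q ^ℕ suc b)      ∎

^ℤ-diff : ∀ {q} → q ≢ 0ℚ → ∀ a b → q ^ℤ (+ a ℤ.- + b) ≡ q ^ℕ a * inv (q ^ℕ b)
^ℤ-diff {q} q≢0 a b = trans (cong (q ^ℤ_) (ℤ.[+m]-[+n]≡m⊖n a b)) (^ℤ-⊖ q≢0 a b)

∣^ℕ∣ : ∀ q m → ∣ q ^ℕ m ∣ ≡ ∣ q ∣ ^ℕ m
∣^ℕ∣ q zero    = refl
∣^ℕ∣ q (suc m) = trans (ℚ.∣p*q∣≡∣p∣*∣q∣ q (q ^ℕ m)) (cong (∣ q ∣ *_) (∣^ℕ∣ q m))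

module _ (a : ℚ) {{_ : NonNegative a}} where

  <1⇒^ℕ-suc<1 : a < 1ℚ → ∀ m → a ^ℕ suc m < 1ℚ
  <1⇒^ℕ-suc<1 a<1 zero    = ℚ.≤-<-trans (ℚ.≤-reflexive (ℚ.*-identityʳ a)) a<1
  <1⇒^ℕ-suc<1 a<1 (suc m) = ℚ.≤-<-trans (ℚ.≤-trans
    (ℚ.*-monoˡ-≤-nonNeg a (ℚ.<⇒≤ (<1⇒^ℕ-suc<1 a<1 m))) (ℚ.≤-reflexive (ℚ.*-identityʳ a))) a<1

  >1⇒^ℕ-suc>1 : 1ℚ < a → ∀ m → 1ℚ < a ^ℕ suc m
  >1⇒^ℕ-suc>1 a>1 zero    = ℚ.<-≤-trans a>1 (ℚ.≤-reflexive (sym (ℚ.*-identityʳ a)))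
  >1⇒^ℕ-suc>1 a>1 (suc m) = ℚ.<-≤-trans a>1 (ℚ.≤-trans
    (ℚ.≤-reflexive (sym (ℚ.*-identityʳ a))) (ℚ.*-monoˡ-≤-nonNeg a (ℚ.<⇒≤ (>1⇒^ℕ-suc>1 a>1 m))))

  ^ℕ-suc≡1⇒≡1 : ∀ m → a ^ℕ suc m ≡ 1ℚ → a ≡ 1ℚ
  ^ℕ-suc≡1⇒≡1 m aᵐ⁺¹≡1 with ℚ.<-cmp a 1ℚ
  ... | tri< a<1 _ _ = contradiction aᵐ⁺¹≡1 (ℚ.<⇒≢ (<1⇒^ℕ-suc<1 a<1 m))
  ... | tri≈ _ a≡1 _ = a≡1
  ... | tri> _ _ a>1 = contradiction (sym aᵐ⁺¹≡1) (ℚ.<⇒≢ (>1⇒^ℕ-suc>1 a>1 m))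

^ℕ-suc≢1 : ∀ {q} → q ≢ 1ℚ → q ≢ - 1ℚ → ∀ m → q ^ℕ suc m ≢ 1ℚ
^ℕ-suc≢1 {q} q≢1 q≢-1 m qᵐ⁺¹≡1
  with ℚ.∣p∣≡p∨∣p∣≡-p q
     | ^ℕ-suc≡1⇒≡1 ∣ q ∣ {{ℚ.∣-∣-nonNeg q}} m (trans (sym (∣^ℕ∣ q (suc m))) (cong ∣_∣ qᵐ⁺¹≡1))
... | inj₁ ∣q∣≡q  | ∣q∣≡1 = q≢1 (trans (sym ∣q∣≡q) ∣q∣≡1)
... | inj₂ ∣q∣≡-q | ∣q∣≡1 = q≢-1 (ℚ.neg-injective (trans (sym ∣q∣≡-q) ∣q∣≡1))

^ℕ-<⇒≢ : ∀ {q} → q ≢ 0ℚ → (∀ m → q ^ℕ suc m ≢ 1ℚ) → ∀ {a b} → a ℕ.< b → q ^ℕ a ≢ q ^ℕ b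
^ℕ-<⇒≢ {q} q≢0 q≢root {a} {b} a<b qᵃ≡qᵇ = q≢root d (sym (*-cancelʳ-≡ (^ℕ-≢0 q≢0 a) (begin
  1ℚ * q ^ℕ a            ≡⟨ ℚ.*-identityˡ (q ^ℕ a) ⟩
  q ^ℕ a                 ≡⟨ qᵃ≡qᵇ ⟩
  q ^ℕ b                 ≡⟨ cong (q ^ℕ_) b≡a+[1+d] ⟨
  q ^ℕ (a ℕ.+ suc d)     ≡⟨ ^ℕ-distribˡ-+-* q a (suc d) ⟩
  q ^ℕ a * q ^ℕ suc d    ≡⟨ ℚ.*-comm (q ^ℕ a) (q ^ℕ suc d) ⟩
  q ^ℕ suc d * q ^ℕ a    ∎)))
  where
  d : ℕ
  d = b ℕ.∸ suc a
  b≡a+[1+d] : a ℕ.+ suc d ≡ b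
  b≡a+[1+d] = trans (ℕ.+-suc a d) (ℕ.m+[n∸m]≡n a<b)

poch-suc-left : ∀ b q k → poch b q (suc k) ≡ (1ℚ - b) * poch (b * q) q k
poch-suc-left b q zero = solve 1 (λ b → con 1ℚ :* (con 1ℚ :- b :* con 1ℚ) := (con 1ℚ :- b) :* con 1ℚ) refl b
  where open +-*-Solver using (con; _:-_)
poch-suc-left b q (suc k) = begin
  poch b q (suc k) * (1ℚ - b * q ^ℕ suc k)            ≡⟨ cong (_* (1ℚ - b * q ^ℕ suc k)) (poch-suc-left b q k) ⟩
  (1ℚ - b) * P * (1ℚ - b * (q * q ^ℕ k))               ≡⟨ solve 4 (λ b q P Y → (con 1ℚ :- b) :* P :* (con 1ℚ :- b :* (q :* Y))
                                                            := (con 1ℚ :- b) :* (P :* (con 1ℚ :- b :* q :* Y))) refl b q P (q ^ℕ k) ⟩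
  (1ℚ - b) * (P * (1ℚ - b * q * q ^ℕ k))               ∎
  where
  open +-*-Solver using (con; _:-_)
  P : ℚ
  P = poch (b * q) q k

poch-≢0 : ∀ {b q} k → (∀ i → i ℕ.< k → b * q ^ℕ i ≢ 1ℚ) → poch b q k ≢ 0ℚ
poch-≢0 zero    _         = ℚ.1≢0
poch-≢0 (suc k) factor≢1 =
  *-≢0 (poch-≢0 k (λ i i<k → factor≢1 i (ℕ.m<n⇒m<1+n i<k))) (-≢0 (factor≢1 k (ℕ.n<1+n k) ∘ sym))

sum1-peel : ∀ n f → sum1 (suc n) f ≡ f 1 + sum1 n (f ∘ suc)
sum1-peel zero    f = ℚ.+-comm 0ℚ (f 1)
sum1-peel (suc n) f = begin
  sum1 (suc n) f + f (suc (suc n))                       ≡⟨ cong (_+ f (suc (suc n))) (sum1-peel n f) ⟩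
  f 1 + sum1 n (f ∘ suc) + f (suc (suc n))               ≡⟨ ℚ.+-assoc (f 1) (sum1 n (f ∘ suc)) (f (suc (suc n))) ⟩
  f 1 + (sum1 n (f ∘ suc) + f (suc (suc n)))             ∎

*-distribˡ-sum1 : ∀ x n f → x * sum1 n f ≡ sum1 n (λ k → x * f k)
*-distribˡ-sum1 x zero    f = ℚ.*-zeroʳ x
*-distribˡ-sum1 x (suc n) f = begin
  x * (sum1 n f + f (suc n))                 ≡⟨ ℚ.*-distribˡ-+ x (sum1 n f) (f (suc n)) ⟩
  x * sum1 n f + x * f (suc n)               ≡⟨ cong (_+ x * f (suc n)) (*-distribˡ-sum1 x n f) ⟩
  sum1 n (λ k → x * f k) + x * f (suc n)     ∎

sum1-+ : ∀ n f g → sum1 n (λ k → f k + g k) ≡ sum1 n f + sum1 n g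
sum1-+ zero    f g = refl
sum1-+ (suc n) f g = begin
  sum1 n (λ k → f k + g k) + (f (suc n) + g (suc n))   ≡⟨ cong (_+ (f (suc n) + g (suc n))) (sum1-+ n f g) ⟩
  sum1 n f + sum1 n g + (f (suc n) + g (suc n))        ≡⟨ solve 4 (λ a b c d → a :+ b :+ (c :+ d) := a :+ c :+ (b :+ d))
                                                            refl (sum1 n f) (sum1 n g) (f (suc n)) (g (suc n)) ⟩
  sum1 n f + f (suc n) + (sum1 n g + g (suc n))        ∎

sum1-cong : ∀ n {f g} → (∀ j → j ℕ.< n → f (suc j) ≡ g (suc j)) → sum1 n f ≡ sum1 n g
sum1-cong zero    _   = refl
sum1-cong (suc n) f≗g = cong₂ _+_ (sum1-cong n (λ j j<n → f≗g j (ℕ.m<n⇒m<1+n j<n))) (f≗g n (ℕ.n<1+n n))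

sum1-telescope : ∀ (h : ℕ → ℚ) n → sum1 n (λ k → h k - h (ℕ.pred k)) ≡ h n - h 0
sum1-telescope h zero    = sym (ℚ.+-inverseʳ (h 0))
sum1-telescope h (suc n) = begin
  sum1 n (λ k → h k - h (ℕ.pred k)) + (h (suc n) - h n)   ≡⟨ cong (_+ (h (suc n) - h n)) (sum1-telescope h n) ⟩
  h n - h 0 + (h (suc n) - h n)                            ≡⟨ solve 3 (λ a b c → a :- b :+ (c :- a) := c :- b) refl (h n) (h 0) (h (suc n)) ⟩
  h (suc n) - h 0                                          ∎
  where open +-*-Solver using (_:-_)

sum1-unique : ∀ (f g : ℕ → ℚ) → f 0 ≡ 0ℚ → (∀ n → f (suc n) ≡ f n + g (suc n)) →
              ∀ n → f n ≡ sum1 n g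
sum1-unique f g f0≡0 f-step zero    = f0≡0
sum1-unique f g f0≡0 f-step (suc n) = trans (f-step n) (cong (_+ g (suc n)) (sum1-unique f g f0≡0 f-step n))

triangle-suc : ∀ n → (suc n ℕ.+ 1) C 2 ≡ (n ℕ.+ 1) C 2 ℕ.+ suc n
triangle-suc n = begin
  suc (n ℕ.+ 1) C 2                   ≡⟨ nCk+nC[k+1]≡[n+1]C[k+1] (n ℕ.+ 1) 1 ⟨
  (n ℕ.+ 1) C 1 ℕ.+ (n ℕ.+ 1) C 2     ≡⟨ cong (ℕ._+ (n ℕ.+ 1) C 2) (trans (nC1≡n (n ℕ.+ 1)) (ℕ.+-comm n 1)) ⟩
  suc n ℕ.+ (n ℕ.+ 1) C 2             ≡⟨ ℕ.+-comm (suc n) ((n ℕ.+ 1) C 2) ⟩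
  (n ℕ.+ 1) C 2 ℕ.+ suc n             ∎

module Identity {q : ℚ} (q≢0 : q ≢ 0ℚ) (qᵐ⁺¹≢1 : ∀ m → q ^ℕ suc m ≢ 1ℚ) where

  prefactor : ℕ → ℚ
  prefactor n = sgn n * q ^ℕ ((n ℕ.+ 1) C 2)

  term : ℕ → ℕ → ℚ
  term n k = (q ^ℤ (ℤ.- (+ (n ℕ.* k))) * poch q q k)
             ÷ (qint q (+ k) * qint q ((+ k) ℤ.- (+ (n ℕ.+ 1))) * poch (q ^ℤ (ℤ.- (+ n))) q k)

  rhs₁ rhs₂ : ℕ → ℚ
  rhs₁ k = (sgn k * q ^ℕ ((k ℕ.+ 1) C 2) * (1ℚ + q ^ℕ k)) ÷ (qint q (+ k) * qint q (+ k))
  rhs₂ k = q ^ℕ k ÷ (qint q (+ k) * qint q (+ k))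

  ratio : ℕ → ℕ → ℚ
  ratio n k = q ^ℤ (ℤ.- (+ (n ℕ.* k))) * poch q q k ÷ poch (q ^ℤ (ℤ.- (+ n))) q k

  potential : ℕ → ℕ → ℚ
  potential n k = prefactor n * ratio n k ÷ q ^ℕ k

  qᵏ≢0 : ∀ k → q ^ℕ k ≢ 0ℚ
  qᵏ≢0 = ^ℕ-≢0 q≢0

  1-q≢0 : 1ℚ - q ≢ 0ℚ
  1-q≢0 = -≢0 (λ 1≡q → qᵐ⁺¹≢1 0 (trans (ℚ.*-identityʳ q) (sym 1≡q)))

  1-qᵏ⁺¹≢0 : ∀ k → 1ℚ - q * q ^ℕ k ≢ 0ℚ
  1-qᵏ⁺¹≢0 k = -≢0 (qᵐ⁺¹≢1 k ∘ sym)

  qᵃ≢qᵇ : ∀ {a b} → a ℕ.< b → q ^ℕ a ≢ q ^ℕ b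
  qᵃ≢qᵇ = ^ℕ-<⇒≢ q≢0 qᵐ⁺¹≢1

  qᵃ/qᵇ≢1 : ∀ {a b} → a ℕ.< b → q ^ℕ a * inv (q ^ℕ b) ≢ 1ℚ
  qᵃ/qᵇ≢1 {a} {b} a<b = qᵃ≢qᵇ a<b ∘ *÷≡1⇒≡ (qᵏ≢0 b)

  q⁻ᵇqᵃ≢1 : ∀ {a b} → a ℕ.< b → inv (q ^ℕ b) * q ^ℕ a ≢ 1ℚ
  q⁻ᵇqᵃ≢1 {a} {b} a<b = qᵃ/qᵇ≢1 a<b ∘ trans (ℚ.*-comm (q ^ℕ a) (inv (q ^ℕ b)))

  1-qᵃ/qᵇ≢0 : ∀ {a b} → a ℕ.< b → 1ℚ - q ^ℕ a * inv (q ^ℕ b) ≢ 0ℚ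
  1-qᵃ/qᵇ≢0 a<b = -≢0 (qᵃ/qᵇ≢1 a<b ∘ sym)

  1-q⁻ᵇqᵃ≢0 : ∀ {a b} → a ℕ.< b → 1ℚ - inv (q ^ℕ b) * q ^ℕ a ≢ 0ℚ
  1-q⁻ᵇqᵃ≢0 a<b = -≢0 (q⁻ᵇqᵃ≢1 a<b ∘ sym)

  qᵇ-qᵃ≢0 : ∀ {a b} → a ℕ.< b → q ^ℕ b - q ^ℕ a ≢ 0ℚ
  qᵇ-qᵃ≢0 a<b = -≢0 (qᵃ≢qᵇ a<b ∘ sym)

  poch-q⁻ⁿ≢0 : ∀ {n k} → k ℕ.≤ n → poch (q ^ℤ ℤ.- (+ n)) q k ≢ 0ℚ
  poch-q⁻ⁿ≢0 {n} {k} k≤n = poch-≢0 k (λ i i<k →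
    subst (λ x → x * q ^ℕ i ≢ 1ℚ) (sym (^ℤ-neg q n)) (q⁻ᵇqᵃ≢1 (ℕ.<-≤-trans i<k k≤n)))

  1-q⁻⁽ⁿ⁺¹⁾≢0 : ∀ n → 1ℚ - inv (q * q ^ℕ n) ≢ 0ℚ
  1-q⁻⁽ⁿ⁺¹⁾≢0 n = subst (λ x → 1ℚ - x ≢ 0ℚ) (ℚ.*-identityʳ (inv (q * q ^ℕ n)))
                        (1-q⁻ᵇqᵃ≢0 {0} {suc n} (ℕ.s≤s ℕ.z≤n))

  prefactor-suc : ∀ n → prefactor (suc n) ≡ - (q * q ^ℕ n) * prefactor n
  prefactor-suc n = begin
    - 1ℚ * S * q ^ℕ ((suc n ℕ.+ 1) C 2)          ≡⟨ cong (λ e → - 1ℚ * S * q ^ℕ e) (triangle-suc n) ⟩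
    - 1ℚ * S * q ^ℕ ((n ℕ.+ 1) C 2 ℕ.+ suc n)    ≡⟨ cong (- 1ℚ * S *_) (^ℕ-distribˡ-+-* q ((n ℕ.+ 1) C 2) (suc n)) ⟩
    - 1ℚ * S * (T * (q * q ^ℕ n))                ≡⟨ solve 4 (λ S T q X → con (- 1ℚ) :* S :* (T :* (q :* X)) := :- (q :* X) :* (S :* T))
                                                      refl S T q (q ^ℕ n) ⟩
    - (q * q ^ℕ n) * (S * T)                     ∎
    where
    open +-*-Solver using (con)
    S T : ℚ
    S = sgn n
    T = q ^ℕ ((n ℕ.+ 1) C 2)

  bracket-shift : ∀ a n → qint q (+ a ℤ.- + (n ℕ.+ 1)) ≡ (1ℚ - q ^ℕ a * inv (q * q ^ℕ n)) ÷ (1ℚ - q)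
  bracket-shift a n = begin
    qint q (+ a ℤ.- + (n ℕ.+ 1))                           ≡⟨ cong (λ x → (1ℚ - x) ÷ (1ℚ - q)) (^ℤ-diff q≢0 a (n ℕ.+ 1)) ⟩
    (1ℚ - q ^ℕ a * inv (q ^ℕ (n ℕ.+ 1))) ÷ (1ℚ - q)        ≡⟨ cong (λ e → (1ℚ - q ^ℕ a * inv (q ^ℕ e)) ÷ (1ℚ - q)) (ℕ.+-comm n 1) ⟩
    (1ℚ - q ^ℕ a * inv (q * q ^ℕ n)) ÷ (1ℚ - q)            ∎

  term-ratio : ∀ n k → term n k ≡ ratio n k ÷ (qint q (+ k) * qint q (+ k ℤ.- + (n ℕ.+ 1)))
  term-ratio n k = begin
    A * inv (B * R)         ≡⟨ cong (A *_) (inv-distrib-* B R) ⟩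
    A * (inv B * inv R)     ≡⟨ solve 3 (λ A B⁻¹ R⁻¹ → A :* (B⁻¹ :* R⁻¹) := A :* R⁻¹ :* B⁻¹) refl A (inv B) (inv R) ⟩
    A * inv R * inv B       ∎
    where
    A B R : ℚ
    A = q ^ℤ (ℤ.- (+ (n ℕ.* k))) * poch q q k
    B = qint q (+ k) * qint q (+ k ℤ.- + (n ℕ.+ 1))
    R = poch (q ^ℤ (ℤ.- (+ n))) q k

  ratio-zero : ∀ n → ratio n 0 ≡ 1ℚ
  ratio-zero n = cong (λ m → q ^ℤ ℤ.- (+ m) * 1ℚ ÷ 1ℚ) (ℕ.*-zeroʳ n)

  ratio-suc : ∀ {n j} → j ℕ.< n → ratio n (suc j) ≡ ratio n j * (1ℚ - q * q ^ℕ j) ÷ (q ^ℕ n - q ^ℕ j)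
  ratio-suc {n} {j} j<n = begin
    ratio n (suc j)
      ≡⟨ cong₂ (λ a b → a * (P * (1ℚ - q * Y)) ÷ (R * (1ℚ - b * Y))) q⁻ⁿ⁽ʲ⁺¹⁾ (^ℤ-neg q n) ⟩
    inv (X * V) * (P * (1ℚ - q * Y)) ÷ (R * (1ℚ - inv X * Y))
      ≡⟨ field-solve 6 (λ q X Y V P R →
           (X ⊗ V) ⁻¹ ⊗ (P ⊗ (one ⊖ q ⊗ Y)) ⊘ (R ⊗ (one ⊖ X ⁻¹ ⊗ Y))
           ⊜ V ⁻¹ ⊗ P ⊘ R ⊗ (one ⊖ q ⊗ Y) ⊘ (X ⊖ Y))
           (q ∷ X ∷ Y ∷ V ∷ P ∷ R ∷ [])
           (qᵏ≢0 n ∷ qᵏ≢0 (n ℕ.* j) ∷ poch-q⁻ⁿ≢0 (ℕ.<⇒≤ j<n) ∷ 1-q⁻ᵇqᵃ≢0 j<n ∷ qᵇ-qᵃ≢0 j<n ∷ [])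
           refl ⟩
    inv V * P ÷ R * (1ℚ - q * Y) ÷ (X - Y)
      ≡⟨ cong (λ a → a * P ÷ R * (1ℚ - q * Y) ÷ (X - Y)) (^ℤ-neg q (n ℕ.* j)) ⟨
    ratio n j * (1ℚ - q * Y) ÷ (X - Y)
      ∎
    where
    X Y V P R : ℚ
    X = q ^ℕ n
    Y = q ^ℕ j
    V = q ^ℕ (n ℕ.* j)
    P = poch q q j
    R = poch (q ^ℤ ℤ.- (+ n)) q j
    q⁻ⁿ⁽ʲ⁺¹⁾ : q ^ℤ ℤ.- (+ (n ℕ.* suc j)) ≡ inv (X * V)
    q⁻ⁿ⁽ʲ⁺¹⁾ = trans (^ℤ-neg q (n ℕ.* suc j))
                 (cong inv (trans (cong (q ^ℕ_) (ℕ.*-suc n j)) (^ℕ-distribˡ-+-* q n (n ℕ.* j))))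

  q⁻⁽ⁿ⁺¹⁾q≡q⁻ⁿ : ∀ n → inv (q * q ^ℕ n) * q ≡ q ^ℤ ℤ.- (+ n)
  q⁻⁽ⁿ⁺¹⁾q≡q⁻ⁿ n = begin
    inv (q * q ^ℕ n) * q    ≡⟨ field-solve 2 (λ q X → (q ⊗ X) ⁻¹ ⊗ q ⊜ X ⁻¹) (q ∷ q ^ℕ n ∷ []) (q≢0 ∷ qᵏ≢0 n ∷ []) refl ⟩
    inv (q ^ℕ n)            ≡⟨ ^ℤ-neg q n ⟨
    q ^ℤ ℤ.- (+ n)          ∎

  ratio-suc-suc : ∀ {n k} → k ℕ.≤ n →
                  ratio (suc n) (suc k) ≡ - (ratio n k * (1ℚ - q * q ^ℕ k)) ÷ ((1ℚ - q * q ^ℕ n) * q ^ℕ k)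
  ratio-suc-suc {n} {k} k≤n = begin
    ratio (suc n) (suc k)
      ≡⟨ cong₂ (λ a b → inv (q * a) * (P * (1ℚ - q * Y)) ÷ b) exponent denominator-peel ⟩
    inv (q * (Y * (X * V))) * (P * (1ℚ - q * Y)) ÷ ((1ℚ - inv (q * X)) * R)
      ≡⟨ field-solve 6 (λ q X Y V P R →
           (q ⊗ (Y ⊗ (X ⊗ V))) ⁻¹ ⊗ (P ⊗ (one ⊖ q ⊗ Y)) ⊘ ((one ⊖ (q ⊗ X) ⁻¹) ⊗ R)
           ⊜ ⊝ (V ⁻¹ ⊗ P ⊘ R ⊗ (one ⊖ q ⊗ Y)) ⊘ ((one ⊖ q ⊗ X) ⊗ Y))
           (q ∷ X ∷ Y ∷ V ∷ P ∷ R ∷ [])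
           (q≢0 ∷ qᵏ≢0 k ∷ qᵏ≢0 n ∷ qᵏ≢0 (n ℕ.* k) ∷ 1-q⁻⁽ⁿ⁺¹⁾≢0 n ∷ poch-q⁻ⁿ≢0 k≤n ∷ 1-qᵏ⁺¹≢0 n ∷ [])
           refl ⟩
    - (inv V * P ÷ R * (1ℚ - q * Y)) ÷ ((1ℚ - q * X) * Y)
      ≡⟨ cong (λ a → - (a * P ÷ R * (1ℚ - q * Y)) ÷ ((1ℚ - q * X) * Y)) (^ℤ-neg q (n ℕ.* k)) ⟨
    - (ratio n k * (1ℚ - q * Y)) ÷ ((1ℚ - q * X) * Y)
      ∎
    where
    X Y V P R : ℚ
    X = q ^ℕ n
    Y = q ^ℕ k
    V = q ^ℕ (n ℕ.* k)
    P = poch q q k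
    R = poch (q ^ℤ ℤ.- (+ n)) q k
    exponent : q ^ℕ (k ℕ.+ n ℕ.* suc k) ≡ Y * (X * V)
    exponent = begin
      q ^ℕ (k ℕ.+ n ℕ.* suc k)           ≡⟨ ^ℕ-distribˡ-+-* q k (n ℕ.* suc k) ⟩
      Y * q ^ℕ (n ℕ.* suc k)             ≡⟨ cong (λ e → Y * q ^ℕ e) (ℕ.*-suc n k) ⟩
      Y * q ^ℕ (n ℕ.+ n ℕ.* k)           ≡⟨ cong (Y *_) (^ℕ-distribˡ-+-* q n (n ℕ.* k)) ⟩
      Y * (X * V)                        ∎
    denominator-peel : poch (inv (q * X)) q (suc k) ≡ (1ℚ - inv (q * X)) * R
    denominator-peel = trans (poch-suc-left (inv (q * X)) q k)
                             (cong (λ b → (1ℚ - inv (q * X)) * poch b q k) (q⁻⁽ⁿ⁺¹⁾q≡q⁻ⁿ n))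

  potential-diagonal : ∀ n → potential n n ≡ 1ℚ
  potential-diagonal zero    = refl
  potential-diagonal (suc n) = begin
    prefactor (suc n) * ratio (suc n) (suc n) * inv (q * X)
      ≡⟨ cong₂ (λ c r → c * r * inv (q * X)) (prefactor-suc n) (ratio-suc-suc {n} {n} ℕ.≤-refl) ⟩
    - (q * X) * C * (- (W * (1ℚ - q * X)) ÷ ((1ℚ - q * X) * X)) * inv (q * X)
      ≡⟨ field-solve 4 (λ q X C W →
           ⊝ (q ⊗ X) ⊗ C ⊗ (⊝ (W ⊗ (one ⊖ q ⊗ X)) ⊘ ((one ⊖ q ⊗ X) ⊗ X)) ⊗ (q ⊗ X) ⁻¹
           ⊜ C ⊗ W ⊘ X)
           (q ∷ X ∷ C ∷ W ∷ []) (1-qᵏ⁺¹≢0 n ∷ qᵏ≢0 n ∷ q≢0 ∷ []) refl ⟩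
    potential n n
      ≡⟨ potential-diagonal n ⟩
    1ℚ ∎
    where
    X C W : ℚ
    X = q ^ℕ n
    C = prefactor n
    W = ratio n n

  term-one : ∀ m → term (suc m) 1 ≡ rhs₂ (suc m)
  term-one m = begin
    term (suc m) 1
      ≡⟨ term-ratio (suc m) 1 ⟩
    ratio (suc m) 1 ÷ ((1ℚ - q * 1ℚ) ÷ (1ℚ - q) * qint q (+ 1 ℤ.- + (suc m ℕ.+ 1)))
      ≡⟨ cong₂ (λ r b → r ÷ ((1ℚ - q * 1ℚ) ÷ (1ℚ - q) * b)) ratio-one (bracket-shift 1 (suc m)) ⟩
    - (1ℚ * (1ℚ - q * 1ℚ)) ÷ ((1ℚ - q * X) * 1ℚ)
      ÷ ((1ℚ - q * 1ℚ) ÷ (1ℚ - q) * ((1ℚ - q * 1ℚ * inv (q * (q * X))) ÷ (1ℚ - q)))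
      ≡⟨ field-solve 2 (λ q X →
           ⊝ (one ⊗ (one ⊖ q ⊗ one)) ⊘ ((one ⊖ q ⊗ X) ⊗ one)
             ⊘ ((one ⊖ q ⊗ one) ⊘ (one ⊖ q) ⊗ ((one ⊖ q ⊗ one ⊗ (q ⊗ (q ⊗ X)) ⁻¹) ⊘ (one ⊖ q)))
           ⊜ q ⊗ X ⊘ ((one ⊖ q ⊗ X) ⊘ (one ⊖ q) ⊗ ((one ⊖ q ⊗ X) ⊘ (one ⊖ q))))
           (q ∷ X ∷ [])
           (1-qᵏ⁺¹≢0 m ∷ ℚ.1≢0 ∷ 1-q≢0 ∷ q≢0 ∷ qᵏ≢0 m ∷ 1-qᵏ⁺¹≢0 0
            ∷ 1-qᵃ/qᵇ≢0 {1} {suc (suc m)} (ℕ.s≤s (ℕ.s≤s ℕ.z≤n)) ∷ [])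
           refl ⟩
    rhs₂ (suc m)
      ∎
    where
    X : ℚ
    X = q ^ℕ m
    ratio-one : ratio (suc m) 1 ≡ - (1ℚ * (1ℚ - q * 1ℚ)) ÷ ((1ℚ - q * X) * 1ℚ)
    ratio-one = trans (ratio-suc-suc {m} {0} ℕ.z≤n)
                      (cong (λ w → - (w * (1ℚ - q * 1ℚ)) ÷ ((1ℚ - q * X) * 1ℚ)) (ratio-zero m))

  term-step : ∀ {n j} → j ℕ.< n →
              prefactor (suc n) * term (suc n) (suc (suc j))
              ≡ prefactor n * term n (suc j) + rhs₂ (suc n) * (potential n (suc j) - potential n j)
  term-step {n} {j} j<n = begin
    prefactor (suc n) * term (suc n) (suc (suc j))
      ≡⟨ cong₂ _*_ (prefactor-suc n) (term-ratio (suc n) (suc (suc j))) ⟩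
    - (q * X) * C * (ratio (suc n) (suc (suc j))
                     ÷ ((1ℚ - q * (q * Y)) ÷ (1ℚ - q) * qint q (+ suc (suc j) ℤ.- + (suc n ℕ.+ 1))))
      ≡⟨ cong₂ (λ r b → - (q * X) * C * (r ÷ ((1ℚ - q * (q * Y)) ÷ (1ℚ - q) * b)))
               ratio-lhs (bracket-shift (suc (suc j)) (suc n)) ⟩
    - (q * X) * C * (- (W₁ * (1ℚ - q * (q * Y))) ÷ ((1ℚ - q * X) * (q * Y))
                     ÷ ((1ℚ - q * (q * Y)) ÷ (1ℚ - q) * ((1ℚ - q * (q * Y) * inv (q * (q * X))) ÷ (1ℚ - q))))
      ≡⟨ field-solve 5 (λ q X Y W C →
           ⊝ (q ⊗ X) ⊗ C ⊗ (⊝ (W ⊗ (one ⊖ q ⊗ Y) ⊘ (X ⊖ Y) ⊗ (one ⊖ q ⊗ (q ⊗ Y))) ⊘ ((one ⊖ q ⊗ X) ⊗ (q ⊗ Y))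
             ⊘ ((one ⊖ q ⊗ (q ⊗ Y)) ⊘ (one ⊖ q) ⊗ ((one ⊖ q ⊗ (q ⊗ Y) ⊗ (q ⊗ (q ⊗ X)) ⁻¹) ⊘ (one ⊖ q))))
           ⊜ C ⊗ (W ⊗ (one ⊖ q ⊗ Y) ⊘ (X ⊖ Y) ⊘ ((one ⊖ q ⊗ Y) ⊘ (one ⊖ q) ⊗ ((one ⊖ q ⊗ Y ⊗ (q ⊗ X) ⁻¹) ⊘ (one ⊖ q))))
             ⊕ q ⊗ X ⊘ ((one ⊖ q ⊗ X) ⊘ (one ⊖ q) ⊗ ((one ⊖ q ⊗ X) ⊘ (one ⊖ q)))
               ⊗ (C ⊗ (W ⊗ (one ⊖ q ⊗ Y) ⊘ (X ⊖ Y)) ⊗ (q ⊗ Y) ⁻¹ ⊖ C ⊗ W ⊗ Y ⁻¹))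
           (q ∷ X ∷ Y ∷ W ∷ C ∷ [])
           (qᵇ-qᵃ≢0 j<n ∷ 1-qᵏ⁺¹≢0 n ∷ q≢0 ∷ qᵏ≢0 j ∷ 1-q≢0 ∷ qᵏ≢0 n ∷ 1-qᵏ⁺¹≢0 (suc j)
            ∷ 1-qᵃ/qᵇ≢0 {suc (suc j)} {suc (suc n)} (ℕ.s≤s (ℕ.s≤s j<n)) ∷ 1-qᵏ⁺¹≢0 j
            ∷ 1-qᵃ/qᵇ≢0 {suc j} {suc n} (ℕ.s≤s j<n) ∷ [])
           refl ⟩
    C * (W₁ ÷ ((1ℚ - q * Y) ÷ (1ℚ - q) * ((1ℚ - q * Y * inv (q * X)) ÷ (1ℚ - q))))
      + rhs₂ (suc n) * (C * W₁ * inv (q * Y) - C * W * inv Y)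
      ≡⟨ cong₂ (λ t r → C * t + rhs₂ (suc n) * (C * r * inv (q * Y) - potential n j)) term-rhs (ratio-suc j<n) ⟨
    prefactor n * term n (suc j) + rhs₂ (suc n) * (potential n (suc j) - potential n j)
      ∎
    where
    X Y C W W₁ : ℚ
    X = q ^ℕ n
    Y = q ^ℕ j
    C = prefactor n
    W = ratio n j
    W₁ = W * (1ℚ - q * Y) ÷ (X - Y)
    ratio-lhs : ratio (suc n) (suc (suc j)) ≡ - (W₁ * (1ℚ - q * (q * Y))) ÷ ((1ℚ - q * X) * (q * Y))
    ratio-lhs = trans (ratio-suc-suc {n} {suc j} j<n)
                      (cong (λ w → - (w * (1ℚ - q * (q * Y))) ÷ ((1ℚ - q * X) * (q * Y))) (ratio-suc j<n))
    term-rhs : term n (suc j) ≡ W₁ ÷ ((1ℚ - q * Y) ÷ (1ℚ - q) * ((1ℚ - q * Y * inv (q * X)) ÷ (1ℚ - q)))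
    term-rhs = trans (term-ratio n (suc j))
                     (cong₂ (λ r b → r ÷ ((1ℚ - q * Y) ÷ (1ℚ - q) * b)) (ratio-suc j<n) (bracket-shift (suc j) n))

  potential-zero : ∀ n → potential n 0 ≡ prefactor n
  potential-zero n = begin
    prefactor n * ratio n 0 * inv 1ℚ    ≡⟨ cong (λ r → prefactor n * r * inv 1ℚ) (ratio-zero n) ⟩
    prefactor n * 1ℚ * 1ℚ               ≡⟨ ℚ.*-identityʳ (prefactor n * 1ℚ) ⟩
    prefactor n * 1ℚ                    ≡⟨ ℚ.*-identityʳ (prefactor n) ⟩
    prefactor n                         ∎

  rhs-step : ∀ n → prefactor (suc n) * rhs₂ (suc n) + rhs₂ (suc n) * (1ℚ - prefactor n)
                   ≡ rhs₁ (suc n) + rhs₂ (suc n)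
  rhs-step n = begin
    prefactor (suc n) * rhs₂ (suc n) + rhs₂ (suc n) * (1ℚ - C)
      ≡⟨ cong (λ c → c * rhs₂ (suc n) + rhs₂ (suc n) * (1ℚ - C)) (prefactor-suc n) ⟩
    - (q * X) * C * (q * X ÷ (B * B)) + q * X ÷ (B * B) * (1ℚ - C)
      ≡⟨ field-solve 3 (λ q X C →
           ⊝ (q ⊗ X) ⊗ C ⊗ (q ⊗ X ⊘ (B′ q X ⊗ B′ q X)) ⊕ q ⊗ X ⊘ (B′ q X ⊗ B′ q X) ⊗ (one ⊖ C)
           ⊜ ⊝ (q ⊗ X) ⊗ C ⊗ (one ⊕ q ⊗ X) ⊘ (B′ q X ⊗ B′ q X) ⊕ q ⊗ X ⊘ (B′ q X ⊗ B′ q X))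
           (q ∷ X ∷ C ∷ []) (1-q≢0 ∷ 1-qᵏ⁺¹≢0 n ∷ []) refl ⟩
    - (q * X) * C * (1ℚ + q * X) ÷ (B * B) + q * X ÷ (B * B)
      ≡⟨ cong (λ c → c * (1ℚ + q * X) ÷ (B * B) + q * X ÷ (B * B)) (prefactor-suc n) ⟨
    rhs₁ (suc n) + rhs₂ (suc n)
      ∎
    where
    X C B : ℚ
    X = q ^ℕ n
    C = prefactor n
    B = (1ℚ - q * X) ÷ (1ℚ - q)
    B′ : Expr 3 → Expr 3 → Expr 3
    B′ q X = (one ⊖ q ⊗ X) ⊘ (one ⊖ q)

  lhs : ℕ → ℚ
  lhs n = prefactor n * sum1 n (term n)

  lhs-suc : ∀ n → lhs (suc n) ≡ lhs n + (rhs₁ (suc n) + rhs₂ (suc n))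
  lhs-suc n = begin
    c⁺ * sum1 (suc n) (term (suc n))
      ≡⟨ cong (c⁺ *_) (sum1-peel n (term (suc n))) ⟩
    c⁺ * (term (suc n) 1 + sum1 n (term (suc n) ∘ suc))
      ≡⟨ ℚ.*-distribˡ-+ c⁺ (term (suc n) 1) (sum1 n (term (suc n) ∘ suc)) ⟩
    c⁺ * term (suc n) 1 + c⁺ * sum1 n (term (suc n) ∘ suc)
      ≡⟨ cong₂ _+_ (cong (c⁺ *_) (term-one n)) (*-distribˡ-sum1 c⁺ n (term (suc n) ∘ suc)) ⟩
    c⁺ * K + sum1 n (λ k → c⁺ * term (suc n) (suc k))
      ≡⟨ cong (_+_ (c⁺ * K)) (sum1-cong n (λ j j<n → term-step j<n)) ⟩
    c⁺ * K + sum1 n (λ k → c * term n k + K * (h k - h (ℕ.pred k)))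
      ≡⟨ cong (_+_ (c⁺ * K)) (sum1-+ n (λ k → c * term n k) (λ k → K * (h k - h (ℕ.pred k)))) ⟩
    c⁺ * K + (sum1 n (λ k → c * term n k) + sum1 n (λ k → K * (h k - h (ℕ.pred k))))
      ≡⟨ cong (_+_ (c⁺ * K)) (cong₂ _+_ (*-distribˡ-sum1 c n (term n)) telescoped) ⟨
    c⁺ * K + (lhs n + K * (h n - h 0))
      ≡⟨ cong₂ (λ x y → c⁺ * K + (lhs n + K * (x - y))) (potential-diagonal n) (potential-zero n) ⟩
    c⁺ * K + (lhs n + K * (1ℚ - c))
      ≡⟨ solve 3 (λ a L b → a :+ (L :+ b) := L :+ (a :+ b)) refl (c⁺ * K) (lhs n) (K * (1ℚ - c)) ⟩
    lhs n + (c⁺ * K + K * (1ℚ - c))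
      ≡⟨ cong (_+_ (lhs n)) (rhs-step n) ⟩
    lhs n + (rhs₁ (suc n) + rhs₂ (suc n))
      ∎
    where
    c⁺ c K : ℚ
    c⁺ = prefactor (suc n)
    c  = prefactor n
    K  = rhs₂ (suc n)
    h : ℕ → ℚ
    h  = potential n
    telescoped : K * (h n - h 0) ≡ sum1 n (λ k → K * (h k - h (ℕ.pred k)))
    telescoped = trans (cong (K *_) (sym (sum1-telescope h n))) (*-distribˡ-sum1 K n (λ k → h k - h (ℕ.pred k)))

  lhs≡rhs : ∀ n → lhs n ≡ sum1 n rhs₁ + sum1 n rhs₂
  lhs≡rhs n = trans (sum1-unique lhs (λ k → rhs₁ k + rhs₂ k) refl lhs-suc n) (sum1-+ n rhs₁ rhs₂)

lemma2p10 : (n : ℕ) → n ≥ 1 → (q : ℚ) → q ≢ 0ℚ → q ≢ 1ℚ → q ≢ - 1ℚ →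
    sgn n * q ^ℕ ((n ℕ.+ 1) C 2)
        * sum1 n (λ k → (q ^ℤ (ℤ.- (+ (n ℕ.* k))) * poch q q k)
                         ÷ (qint q (+ k) * qint q ((+ k) ℤ.- (+ (n ℕ.+ 1)))
                            * poch (q ^ℤ (ℤ.- (+ n))) q k))
      ≡ sum1 n (λ k → (sgn k * q ^ℕ ((k ℕ.+ 1) C 2) * (1ℚ + q ^ℕ k))
                       ÷ (qint q (+ k) * qint q (+ k)))
        + sum1 n (λ k → q ^ℕ k ÷ (qint q (+ k) * qint q (+ k)))
lemma2p10 n _ q q≢0 q≢1 q≢-1 = Identity.lhs≡rhs q≢0 (^ℕ-suc≢1 q≢1 q≢-1) n
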